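{- Let $C$ be a neighbour-transitive code in $K(n,k)$ with minimum distance $\delta\geq 3$ and let $\alpha\in C$. Then the stabiliser $\mathrm{Aut}(C)_\alpha$ acts transitively on $\varGamma_1(\alpha)$ and acts $(n-2k)$-homogeneously on $\Omega\setminus\alpha$.
   Context: Let $\Omega$ be a finite set with $|\Omega|=n$ and $2\leq k\leq (n-1)/2$. The Kneser graph $\varGamma=K(n,k)$ has as vertices the $k$-subsets of $\Omega$, adjacent iff disjoint; its automorphism group is $\mathrm{Sym}(\Omega)$. $\varGamma_1(\alpha)$ is the set of neighbours of $\alpha$. A code $C$ is a set of vertices with $|C|\geq 2$; with $d$ graph distance, the minimum distance $\delta$ is the least distance between distinct codewords; $C_1$ is the set of vertices not in $C$ but adjacent to a codeword; $\mathrm{Aut}(C)$ is the setwise stabiliser of $C$ in $\mathrm{Sym}(\Omega)$; $C$ is neighbour-transitive if $C_1\neq\emptyset$ and $\mathrm{Aut}(C)$ is transitive on $C$ and on $C_1$. A group acting on a set $X$ is $t$-homogeneous if it is transitive on the $t$-subsets of $X$. -}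

module Defs where

open import Data.Nat using (ℕ; zero; suc; _<_)
open import Data.Fin using (Fin)
open import Data.Fin.Subset using (Subset; _∈_; _⊆_; ∁; ∣_∣)
open import Data.Fin.Permutation using (Permutation′; _⟨$⟩ˡ_)
open import Data.Vec using (tabulate; lookup)
open import Data.Product using (Σ; _×_; _,_; ∃)
open import Relation.Nullary using (¬_)
open import Relation.Binary.PropositionalEquality using (_≡_; _≢_)
open import Function.Bundles using (_⇔_)

-- Ω = Fin n.  Vertices of K(n,k): subsets of Fin n of size k.
IsVertex : ∀ {n} → ℕ → Subset n → Set
IsVertex k s = ∣ s ∣ ≡ k

-- adjacency in K(n,k): disjointness
Disjoint : ∀ {n} → Subset n → Subset n → Set
Disjoint s t = ∀ i → i ∈ s → i ∈ t → Data.Empty.⊥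
  where import Data.Empty

data Walk {n : ℕ} (k : ℕ) : ℕ → Subset n → Subset n → Set where
  here : ∀ {x} → IsVertex k x → Walk k zero x x
  step : ∀ {m x y z} → IsVertex k x → Disjoint x y → Walk k m y z → Walk k (suc m) x z

DistAtLeast : ∀ {n} → ℕ → Subset n → Subset n → ℕ → Set
DistAtLeast {n} k x y r = ∀ m → m < r → ¬ Walk {n} k m x y

-- action of Sym(Ω) on subsets: i ∈ σ(s) iff σ⁻¹(i) ∈ s
image : ∀ {n} → Permutation′ n → Subset n → Subset n
image σ s = tabulate (λ i → lookup s (σ ⟨$⟩ˡ i))

Code : ℕ → Set₁
Code n = Subset n → Set

IsCode : ∀ {n} → ℕ → Code n → Set
IsCode k C = (∀ s → C s → IsVertex k s)
           × Σ _ (λ a → Σ _ (λ b → C a × C b × a ≢ b))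

MinDistAtLeast : ∀ {n} → ℕ → Code n → ℕ → Set
MinDistAtLeast k C r = ∀ a b → C a → C b → a ≢ b → DistAtLeast k a b r

InC₁ : ∀ {n} → ℕ → Code n → Subset n → Set
InC₁ k C v = IsVertex k v × ¬ C v × Σ _ (λ c → C c × Disjoint c v)

InAut : ∀ {n} → Code n → Permutation′ n → Set
InAut C σ = ∀ s → C s ⇔ C (image σ s)

TransitiveOn : ∀ {n} → (Permutation′ n → Set) → (Subset n → Set) → Set
TransitiveOn {n} G X =
  ∀ x y → X x → X y → Σ (Permutation′ n) (λ σ → G σ × image σ x ≡ y)

NeighbourTransitive : ∀ {n} → ℕ → Code n → Set
NeighbourTransitive k C =
  ∃ (InC₁ k C) × TransitiveOn (InAut C) C × TransitiveOn (InAut C) (InC₁ k C)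

InStab : ∀ {n} → Code n → Subset n → Permutation′ n → Set
InStab C α σ = InAut C σ × image σ α ≡ α

Γ₁ : ∀ {n} → ℕ → Subset n → Subset n → Set
Γ₁ k α β = IsVertex k β × Disjoint α β

Homogeneous : ∀ {n} → (Permutation′ n → Set) → ℕ → Subset n → Set
Homogeneous G t Y = TransitiveOn G (λ X → X ⊆ Y × ∣ X ∣ ≡ t)

-- A neighbour β of a codeword α lies in C₁, since δ ≥ 2.  If σ ∈ Aut(C) maps one neighbour
-- of α to another, then σα = α: otherwise σα, σβ, α would be a walk of length 2 between
-- distinct codewords, contradicting δ ≥ 3.  So transitivity of Aut(C) on C₁ restricts to
-- transitivity of Aut(C)_α on Γ₁(α).  Finally X ↦ Ω ∖ (α ∪ X) is an Aut(C)_α-equivariant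
-- bijection from the (n − 2k)-subsets of Ω ∖ α onto Γ₁(α), with inverse β ↦ (Ω ∖ α) ∖ β,
-- which turns transitivity on Γ₁(α) into (n − 2k)-homogeneity on Ω ∖ α.
module Submission where

open import Defs
open import Data.Nat using (ℕ; _≤_; _+_; _*_; _∸_; suc; s≤s; z≤n)
open import Data.Nat.Properties
  using (+-suc; +-comm; +-identityʳ; ∸-+-assoc; m∸[m∸n]≡n; m+n∸m≡n; m≤m+n; ≤-trans)
open import Data.Bool using (Bool; not; _∧_; _≟_)
open import Data.Fin.Subset using (Subset; ∁; _∪_; _∩_; ⊥; ∣_∣; _∈_; _⊆_; inside; outside)
open import Data.Fin.Subset.Properties
  using ( ∣⊥∣≡0; ∣∁p∣≡n∸∣p∣; Empty-unique; ⊆-antisym; p∩q⊆q; x∈p∩q⁺; x∈p∩q⁻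
        ; x∈p∪q⁺; x∈∁p⇒x∉p; ∩-distribˡ-∪; ∩-inverseˡ; ∪-identityˡ; ∪-∩-booleanAlgebra)
open import Data.Fin.Permutation using (Permutation′; _⟨$⟩ˡ_)
open import Data.Vec using (Vec; []; _∷_; lookup; tabulate; map; zipWith)
open import Data.Vec.Properties
  using (lookup∘tabulate; tabulate∘lookup; tabulate-cong; lookup-map; lookup-zipWith
        ; []=⇒lookup; lookup⇒[]=; ≡-dec)
open import Data.Product using (_×_; _,_; proj₁)
open import Data.Sum using (inj₁)
open import Relation.Nullary using (¬_; contradiction)
open import Relation.Nullary.Decidable using (decidable-stable)
open import Relation.Binary.PropositionalEquality
open import Function.Bundles using (Equivalence)
import Algebra.Lattice.Properties.BooleanAlgebra as BooleanAlgebraProperties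

lookup-extensionality : ∀ {a} {A : Set a} {n} (xs ys : Vec A n)
  → (∀ i → lookup xs i ≡ lookup ys i) → xs ≡ ys
lookup-extensionality xs ys eq = begin
  xs                   ≡⟨ tabulate∘lookup xs ⟨
  tabulate (lookup xs) ≡⟨ tabulate-cong eq ⟩
  tabulate (lookup ys) ≡⟨ tabulate∘lookup ys ⟩
  ys                   ∎
  where open ≡-Reasoning

∁-involutive : ∀ {n} (p : Subset n) → ∁ (∁ p) ≡ p
∁-involutive {n} = ¬-involutive
  where open BooleanAlgebraProperties (∪-∩-booleanAlgebra n) using (¬-involutive)

∁-injective : ∀ {n} {p q : Subset n} → ∁ p ≡ ∁ q → p ≡ q
∁-injective {p = p} {q} eq =
  trans (sym (∁-involutive p)) (trans (cong ∁ eq) (∁-involutive q))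

∣p∪q∣+∣p∩q∣≡∣p∣+∣q∣ : ∀ {n} (p q : Subset n) → ∣ p ∪ q ∣ + ∣ p ∩ q ∣ ≡ ∣ p ∣ + ∣ q ∣
∣p∪q∣+∣p∩q∣≡∣p∣+∣q∣ [] [] = refl
∣p∪q∣+∣p∩q∣≡∣p∣+∣q∣ (inside ∷ p) (inside ∷ q) =
  cong suc (trans (+-suc ∣ p ∪ q ∣ _)
             (trans (cong suc (∣p∪q∣+∣p∩q∣≡∣p∣+∣q∣ p q)) (sym (+-suc ∣ p ∣ _))))
∣p∪q∣+∣p∩q∣≡∣p∣+∣q∣ (inside ∷ p) (outside ∷ q) = cong suc (∣p∪q∣+∣p∩q∣≡∣p∣+∣q∣ p q)
∣p∪q∣+∣p∩q∣≡∣p∣+∣q∣ (outside ∷ p) (inside ∷ q) =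
  trans (cong suc (∣p∪q∣+∣p∩q∣≡∣p∣+∣q∣ p q)) (sym (+-suc ∣ p ∣ _))
∣p∪q∣+∣p∩q∣≡∣p∣+∣q∣ (outside ∷ p) (outside ∷ q) = ∣p∪q∣+∣p∩q∣≡∣p∣+∣q∣ p q

p⊆∁q⇒q∩p≡⊥ : ∀ {n} {p q : Subset n} → p ⊆ ∁ q → q ∩ p ≡ ⊥
p⊆∁q⇒q∩p≡⊥ {p = p} {q} p⊆∁q = Empty-unique λ (x , x∈q∩p) →
  let (x∈q , x∈p) = x∈p∩q⁻ q p x∈q∩p in x∈∁p⇒x∉p (p⊆∁q x∈p) x∈q

∣p∪q∣≡∣p∣+∣q∣ : ∀ {n} {p q : Subset n} → q ⊆ ∁ p → ∣ p ∪ q ∣ ≡ ∣ p ∣ + ∣ q ∣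
∣p∪q∣≡∣p∣+∣q∣ {n} {p} {q} q⊆∁p = begin
  ∣ p ∪ q ∣               ≡⟨ +-identityʳ _ ⟨
  ∣ p ∪ q ∣ + 0           ≡⟨ cong (∣ p ∪ q ∣ +_) (∣⊥∣≡0 n) ⟨
  ∣ p ∪ q ∣ + ∣ ⊥ {n} ∣   ≡⟨ cong (λ r → ∣ p ∪ q ∣ + ∣ r ∣) (p⊆∁q⇒q∩p≡⊥ q⊆∁p) ⟨
  ∣ p ∪ q ∣ + ∣ p ∩ q ∣   ≡⟨ ∣p∪q∣+∣p∩q∣≡∣p∣+∣q∣ p q ⟩
  ∣ p ∣ + ∣ q ∣           ∎
  where open ≡-Reasoning

∁p∩[p∪q]≡q : ∀ {n} {p q : Subset n} → q ⊆ ∁ p → ∁ p ∩ (p ∪ q) ≡ q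
∁p∩[p∪q]≡q {p = p} {q} q⊆∁p = begin
  ∁ p ∩ (p ∪ q)           ≡⟨ ∩-distribˡ-∪ (∁ p) p q ⟩
  ∁ p ∩ p ∪ ∁ p ∩ q       ≡⟨ cong (_∪ ∁ p ∩ q) (∩-inverseˡ p) ⟩
  ⊥ ∪ ∁ p ∩ q             ≡⟨ ∪-identityˡ _ ⟩
  ∁ p ∩ q                 ≡⟨ ⊆-antisym (p∩q⊆q (∁ p) q) (λ x∈q → x∈p∩q⁺ (q⊆∁p x∈q , x∈q)) ⟩
  q                       ∎
  where open ≡-Reasoning

n∸[k+[n∸2k]]≡k : ∀ n k → 2 * k ≤ n → n ∸ (k + (n ∸ 2 * k)) ≡ k
n∸[k+[n∸2k]]≡k n k 2k≤n = begin
  n ∸ (k + (n ∸ 2 * k))   ≡⟨ cong (n ∸_) (+-comm k _) ⟩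
  n ∸ (n ∸ 2 * k + k)     ≡⟨ ∸-+-assoc n (n ∸ 2 * k) k ⟨
  n ∸ (n ∸ 2 * k) ∸ k     ≡⟨ cong (_∸ k) (m∸[m∸n]≡n 2k≤n) ⟩
  k + (k + 0) ∸ k         ≡⟨ m+n∸m≡n k _ ⟩
  k + 0                   ≡⟨ +-identityʳ k ⟩
  k                       ∎
  where open ≡-Reasoning

lookup-image : ∀ {n} (σ : Permutation′ n) s i → lookup (image σ s) i ≡ lookup s (σ ⟨$⟩ˡ i)
lookup-image σ s = lookup∘tabulate (λ i → lookup s (σ ⟨$⟩ˡ i))

image-map : ∀ {n} (σ : Permutation′ n) (f : Bool → Bool) s → image σ (map f s) ≡ map f (image σ s)
image-map σ f s = lookup-extensionality _ _ λ i → begin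
  lookup (image σ (map f s)) i  ≡⟨ lookup-image σ (map f s) i ⟩
  lookup (map f s) (σ ⟨$⟩ˡ i)   ≡⟨ lookup-map _ f s ⟩
  f (lookup s (σ ⟨$⟩ˡ i))       ≡⟨ cong f (lookup-image σ s i) ⟨
  f (lookup (image σ s) i)      ≡⟨ lookup-map i f (image σ s) ⟨
  lookup (map f (image σ s)) i  ∎
  where open ≡-Reasoning

image-zipWith : ∀ {n} (σ : Permutation′ n) (f : Bool → Bool → Bool) s t
  → image σ (zipWith f s t) ≡ zipWith f (image σ s) (image σ t)
image-zipWith σ f s t = lookup-extensionality _ _ λ i → begin
  lookup (image σ (zipWith f s t)) i               ≡⟨ lookup-image σ (zipWith f s t) i ⟩
  lookup (zipWith f s t) (σ ⟨$⟩ˡ i)                ≡⟨ lookup-zipWith f _ s t ⟩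
  f (lookup s (σ ⟨$⟩ˡ i)) (lookup t (σ ⟨$⟩ˡ i))    ≡⟨ cong₂ f (lookup-image σ s i)
                                                             (lookup-image σ t i) ⟨
  f (lookup (image σ s) i) (lookup (image σ t) i)  ≡⟨ lookup-zipWith f i (image σ s) _ ⟨
  lookup (zipWith f (image σ s) (image σ t)) i     ∎
  where open ≡-Reasoning

∈-image⁻ : ∀ {n} (σ : Permutation′ n) {s i} → i ∈ image σ s → σ ⟨$⟩ˡ i ∈ s
∈-image⁻ σ {s} {i} i∈σs = lookup⇒[]= _ s (trans (sym (lookup-image σ s i)) ([]=⇒lookup i∈σs))

Disjoint-image : ∀ {n} (σ : Permutation′ n) {s t : Subset n}
  → Disjoint s t → Disjoint (image σ s) (image σ t)
Disjoint-image σ s#t i i∈σs i∈σt = s#t (σ ⟨$⟩ˡ i) (∈-image⁻ σ i∈σs) (∈-image⁻ σ i∈σt)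

Disjoint-sym : ∀ {n} {s t : Subset n} → Disjoint s t → Disjoint t s
Disjoint-sym s#t i i∈t i∈s = s#t i i∈s i∈t

Disjoint-∁∪ : ∀ {n} (s t : Subset n) → Disjoint s (∁ (s ∪ t))
Disjoint-∁∪ s t i i∈s i∈∁[s∪t] = x∈∁p⇒x∉p i∈∁[s∪t] (x∈p∪q⁺ (inj₁ i∈s))

image-∁[s∪p]≡∁[s∪q]⇒image-p≡q : ∀ {n} (σ : Permutation′ n) {s p q : Subset n}
  → image σ s ≡ s → p ⊆ ∁ s → q ⊆ ∁ s → image σ (∁ (s ∪ p)) ≡ ∁ (s ∪ q) → image σ p ≡ q
image-∁[s∪p]≡∁[s∪q]⇒image-p≡q σ {s} {p} {q} σs≡s p⊆∁s q⊆∁s σ∁[s∪p]≡∁[s∪q] = begin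
  image σ p                         ≡⟨ cong (image σ) (∁p∩[p∪q]≡q p⊆∁s) ⟨
  image σ (∁ s ∩ (s ∪ p))           ≡⟨ image-zipWith σ _∧_ (∁ s) (s ∪ p) ⟩
  image σ (∁ s) ∩ image σ (s ∪ p)   ≡⟨ cong₂ _∩_ σ∁s≡∁s σ[s∪p]≡s∪q ⟩
  ∁ s ∩ (s ∪ q)                     ≡⟨ ∁p∩[p∪q]≡q q⊆∁s ⟩
  q                                 ∎
  where
  open ≡-Reasoning
  σ∁s≡∁s : image σ (∁ s) ≡ ∁ s
  σ∁s≡∁s = trans (image-map σ not s) (cong ∁ σs≡s)
  σ[s∪p]≡s∪q : image σ (s ∪ p) ≡ s ∪ q
  σ[s∪p]≡s∪q = ∁-injective (trans (sym (image-map σ not (s ∪ p))) σ∁[s∪p]≡∁[s∪q])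

Disjoint⇒≢ : ∀ {n k} {s t : Subset n} → 1 ≤ k → IsVertex k s → Disjoint s t → s ≢ t
Disjoint⇒≢ {n} {s = s} 1≤k ∣s∣≡k s#s refl =
  contradiction (subst (1 ≤_) (trans (sym ∣s∣≡k) ∣s∣≡0) 1≤k) λ ()
  where
  ∣s∣≡0 : ∣ s ∣ ≡ 0
  ∣s∣≡0 = trans (cong ∣_∣ (Empty-unique λ (i , i∈s) → s#s i i∈s i∈s)) (∣⊥∣≡0 n)

MinDistAtLeast-weaken : ∀ {n k r s} {C : Code n}
  → r ≤ s → MinDistAtLeast k C s → MinDistAtLeast k C r
MinDistAtLeast-weaken r≤s δ≥s a b ca cb a≢b m m<r = δ≥s a b ca cb a≢b m (≤-trans m<r r≤s)

module _ {n k : ℕ} {C : Code n} (isCode : IsCode k C) {α : Subset n} (α∈C : C α) where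

  private
    codeword-vertex : ∀ {s} → C s → IsVertex k s
    codeword-vertex = proj₁ isCode _

  Γ₁⊆C₁ : 1 ≤ k → MinDistAtLeast k C 2 → ∀ {β} → Γ₁ k α β → InC₁ k C β
  Γ₁⊆C₁ 1≤k δ≥2 {β} (β-vertex , α#β) = β-vertex , β∉C , α , α∈C , α#β
    where
    β∉C : ¬ C β
    β∉C β∈C = δ≥2 α β α∈C β∈C (Disjoint⇒≢ 1≤k (codeword-vertex α∈C) α#β) 1 (s≤s (s≤s z≤n))
                (step (codeword-vertex α∈C) α#β (here β-vertex))

  Aut-fixes-if-maps-Γ₁-into-Γ₁ : MinDistAtLeast k C 3 → ∀ {σ β} → InAut C σ
    → Γ₁ k α β → Γ₁ k α (image σ β) → image σ α ≡ α
  Aut-fixes-if-maps-Γ₁-into-Γ₁ δ≥3 {σ} {β} σ∈Aut (_ , α#β) (σβ-vertex , α#σβ) =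
    decidable-stable (≡-dec _≟_ (image σ α) α) λ σα≢α →
      δ≥3 (image σ α) α σα∈C α∈C σα≢α 2 (s≤s (s≤s (s≤s z≤n)))
        (step (codeword-vertex σα∈C) (Disjoint-image σ α#β)
          (step σβ-vertex (Disjoint-sym α#σβ) (here (codeword-vertex α∈C))))
    where
    σα∈C : C (image σ α)
    σα∈C = Equivalence.to (σ∈Aut α) α∈C

  stabiliser-transitive-on-Γ₁ : 1 ≤ k → MinDistAtLeast k C 3 → NeighbourTransitive k C
    → TransitiveOn (InStab C α) (Γ₁ k α)
  stabiliser-transitive-on-Γ₁ 1≤k δ≥3 (_ , _ , C₁-transitive) β β′ β∈Γ₁ β′∈Γ₁ =
    let σ , σ∈Aut , σβ≡β′ = C₁-transitive β β′ (Γ₁⊆C₁′ β∈Γ₁) (Γ₁⊆C₁′ β′∈Γ₁)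
        σβ′∈Γ₁ = subst (Γ₁ k α) (sym σβ≡β′) β′∈Γ₁
    in σ , (σ∈Aut , Aut-fixes-if-maps-Γ₁-into-Γ₁ δ≥3 {σ} {β} σ∈Aut β∈Γ₁ σβ′∈Γ₁) , σβ≡β′
    where
    Γ₁⊆C₁′ : ∀ {β} → Γ₁ k α β → InC₁ k C β
    Γ₁⊆C₁′ = Γ₁⊆C₁ 1≤k (MinDistAtLeast-weaken (s≤s (s≤s z≤n)) δ≥3)

∁[α∪X]∈Γ₁ : ∀ {n k} {α X : Subset n} → 2 * k ≤ n → IsVertex k α
  → X ⊆ ∁ α → ∣ X ∣ ≡ n ∸ 2 * k → Γ₁ k α (∁ (α ∪ X))
∁[α∪X]∈Γ₁ {n} {k} {α} {X} 2k≤n ∣α∣≡k X⊆∁α ∣X∣≡n∸2k = ∣∁[α∪X]∣≡k , Disjoint-∁∪ α X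
  where
  open ≡-Reasoning
  ∣∁[α∪X]∣≡k : ∣ ∁ (α ∪ X) ∣ ≡ k
  ∣∁[α∪X]∣≡k = begin
    ∣ ∁ (α ∪ X) ∣          ≡⟨ ∣∁p∣≡n∸∣p∣ (α ∪ X) ⟩
    n ∸ ∣ α ∪ X ∣          ≡⟨ cong (n ∸_) (∣p∪q∣≡∣p∣+∣q∣ X⊆∁α) ⟩
    n ∸ (∣ α ∣ + ∣ X ∣)    ≡⟨ cong₂ (λ a x → n ∸ (a + x)) ∣α∣≡k ∣X∣≡n∸2k ⟩
    n ∸ (k + (n ∸ 2 * k))  ≡⟨ n∸[k+[n∸2k]]≡k n k 2k≤n ⟩
    k                      ∎

stabiliser-homogeneous-on-∁ : ∀ {n k} {C : Code n} {α : Subset n} → 2 * k ≤ n → IsVertex k α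
  → TransitiveOn (InStab C α) (Γ₁ k α) → Homogeneous (InStab C α) (n ∸ 2 * k) (∁ α)
stabiliser-homogeneous-on-∁ {α = α} 2k≤n α-vertex Γ₁-transitive X Y (X⊆∁α , ∣X∣) (Y⊆∁α , ∣Y∣) =
  let σ , (σ∈Aut , σα≡α) , σβ≡β′ = Γ₁-transitive (∁ (α ∪ X)) (∁ (α ∪ Y))
                                     (∁[α∪X]∈Γ₁ 2k≤n α-vertex X⊆∁α ∣X∣)
                                     (∁[α∪X]∈Γ₁ 2k≤n α-vertex Y⊆∁α ∣Y∣)
  in σ , (σ∈Aut , σα≡α) , image-∁[s∪p]≡∁[s∪q]⇒image-p≡q σ σα≡α X⊆∁α Y⊆∁α σβ≡β′

lemma6p3 : (n k : ℕ) → 2 ≤ k → 2 * k + 1 ≤ n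
    → (C : Code n) → IsCode k C → NeighbourTransitive k C → MinDistAtLeast k C 3
    → (α : Subset n) → C α
    → TransitiveOn (InStab C α) (Γ₁ k α) × Homogeneous (InStab C α) (n ∸ 2 * k) (∁ α)
lemma6p3 n k 2≤k 2k+1≤n C isCode neighbourTransitive δ≥3 α α∈C =
  Γ₁-transitive , stabiliser-homogeneous-on-∁ 2k≤n (proj₁ isCode α α∈C) Γ₁-transitive
  where
  Γ₁-transitive : TransitiveOn (InStab C α) (Γ₁ k α)
  Γ₁-transitive =
    stabiliser-transitive-on-Γ₁ isCode α∈C (≤-trans (s≤s z≤n) 2≤k) δ≥3 neighbourTransitive
  2k≤n : 2 * k ≤ n
  2k≤n = ≤-trans (m≤m+n (2 * k) 1) 2k+1≤n
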